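{- For all positive integers $m \le k$ there exist $n$ and a Boolean function $g:\{0,1\}^n\to\{0,1\}$ with \[ s_0(g)=m,\qquad bs_0(g)=k,\qquad C_1(g)=\left\lfloor \frac{3\lceil k/m\rceil}{2}\right\rfloor+1. \]
   Context: For $f:\{0,1\}^n\to\{0,1\}$ and $S\subseteq[n]$, $x^S$ denotes $x$ with all bits in $S$ flipped. Sensitivity: $s(f,x)=|\{i: f(x)\ne f(x^{\{i\}})\}|$, and $s_z(f)=\max\{s(f,x): f(x)=z\}$. Block sensitivity $bs(f,x)$ is the maximum $b$ such that there are pairwise disjoint $B_1,\dots,B_b\subseteq[n]$ with $f(x^{B_i})\ne f(x)$ for all $i$, and $bs_z(f)=\max\{bs(f,x): f(x)=z\}$. A certificate is a partial assignment $c:S\to\{0,1\}$, $S\subseteq[n]$, such that $f$ is constant on all inputs agreeing with $c$ on $S$ (a $1$-certificate if that constant is $1$); $C(f,x)$ is the minimum $|S|$ over certificates $c$ that $x$ agrees with, and $C_z(f)=\max\{C(f,x): f(x)=z\}$. -}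

module Defs where

open import Data.Nat using (ℕ; _≤_; _+_; _∸_; _*_; _/_; ⌊_/2⌋; NonZero)
open import Data.Bool using (Bool; true; false; _xor_)
open import Data.Fin using (Fin)
open import Data.Fin.Subset using (Subset; ∣_∣; ⁅_⁆; _∈_)
open import Data.Vec using (Vec; zipWith; tabulate)
open import Data.Product using (Σ; ∃; _×_)
open import Relation.Binary.PropositionalEquality using (_≡_; _≢_)
open import Relation.Nullary using (¬_)

-- Inputs x ∈ {0,1}^n are Bool vectors (false = 0, true = 1).
BoolFun : ℕ → Set
BoolFun n = Vec Bool n → Bool

flipS : ∀ {n} → Vec Bool n → Subset n → Vec Bool n
flipS x S = zipWith _xor_ x S

sens : ∀ {n} → BoolFun n → Vec Bool n → ℕ
sens {n} f x = ∣ tabulate (λ i → f x xor f (flipS x ⁅ i ⁆)) ∣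

IsSensZ : ∀ {n} → BoolFun n → Bool → ℕ → Set
IsSensZ f z m =
  (∃ λ x → f x ≡ z × sens f x ≡ m) × (∀ x → f x ≡ z → sens f x ≤ m)

HasBlocks : ∀ {n} → BoolFun n → Vec Bool n → ℕ → Set
HasBlocks {n} f x b =
  Σ (Fin b → Subset n) λ B →
    (∀ i j → i ≢ j → ∀ l → l ∈ B i → ¬ (l ∈ B j)) ×
    (∀ i → f (flipS x (B i)) ≢ f x)

IsBsZ : ∀ {n} → BoolFun n → Bool → ℕ → Set
IsBsZ f z k =
  (∃ λ x → f x ≡ z × HasBlocks f x k) ×
  (∀ x → f x ≡ z → ∀ b → HasBlocks f x b → b ≤ k)

IsCertFor : ∀ {n} → BoolFun n → Vec Bool n → Subset n → Set
IsCertFor {n} f x S =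
  ∀ y → (∀ (i : Fin n) → i ∈ S → Data.Vec.lookup y i ≡ Data.Vec.lookup x i) → f y ≡ f x

IsCertCx : ∀ {n} → BoolFun n → Vec Bool n → ℕ → Set
IsCertCx f x c =
  (∃ λ S → IsCertFor f x S × ∣ S ∣ ≡ c) ×
  (∀ S → IsCertFor f x S → c ≤ ∣ S ∣)

IsCertZ : ∀ {n} → BoolFun n → Bool → ℕ → Set
IsCertZ f z c =
  (∃ λ x → f x ≡ z × IsCertCx f x c) ×
  (∀ x → f x ≡ z → ∀ c' → IsCertCx f x c' → c' ≤ c)

ceilDiv : (k m : ℕ) → .{{NonZero m}} → ℕ
ceilDiv k m = (k + m ∸ 1) / m

-- Cells l < k are split into m groups (l mod m) of positions (l div m) on the cycle ℤ/t,
-- t = ⌈k/m⌉.  Cell j has two variables a_j, b_j, and g is the OR of the k terms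
--   a_j = b_j = 1,  b_l = 0 for the other cells l of j's group,
--   a_l = 0 for the cells l of j's group at most ⌊t/2⌋ steps before j.
-- Two cells of a group always stand in this relation in at least one direction, so at a
-- 0-input single flips completing terms of the same group coincide: s₀ ≤ m.  Disjoint
-- blocks complete distinct terms, so bs₀ ≤ k, with equality at the all-zero input.  A term
-- fixes at most t + ⌊t/2⌋ + 1 variables, and every variable fixed by a term is sensitive at
-- the minimal input of that term; the term of the cell at position ⌊t/2⌋ of a full group
-- attains the bound, so C₁ = t + ⌊t/2⌋ + 1 = ⌊3t/2⌋ + 1.

module Submission where

open import Defs
open import Data.Bool as Bool using (Bool; true; false; not; _xor_)
open import Data.Bool.Properties using (¬-not; xor-identityʳ; xor-comm; xor-inverseʳ; xor-same)
open import Data.Empty using (⊥; ⊥-elim)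
open import Data.Fin as Fin using (Fin; zero; suc; toℕ; fromℕ<; inject≤; _↑ˡ_; _↑ʳ_; splitAt)
open import Data.Fin.Properties as Finₚ
  using (toℕ<n; toℕ-injective; toℕ-fromℕ<; toℕ-inject≤; inject≤-injective; toℕ-↑ˡ; toℕ-↑ʳ; ↑ˡ-injective; ↑ʳ-injective;
         splitAt⁻¹-↑ˡ; splitAt⁻¹-↑ʳ; injective⇒≤; any?; all?)
open import Data.Fin.Subset using (Subset; ∣_∣; ⁅_⁆; _∈_; _∉_)
open import Data.Fin.Subset.Properties using (_∈?_; x∈⁅x⁆; x∈⁅y⁆⇒x≡y; p⊆q⇒∣p∣≤∣q∣)
open import Data.Nat
open import Data.Nat.Properties
open import Data.Nat.DivMod using (m≡m%n+[m/n]*n; m%n<n; m/n*n≤m; m*n%n≡0; m*n/n≡m; m<n⇒m/n≡0; m<n*o⇒m/o<n)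
open import Data.Product using (Σ; ∃; _×_; _,_; proj₁; proj₂)
open import Data.Sum as Sum using (_⊎_; inj₁; inj₂)
open import Data.Vec using (Vec; _∷_; lookup; tabulate; replicate; here; there)
open import Data.Vec.Properties using (lookup∘tabulate; lookup-replicate; lookup-zipWith; []=⇒lookup; lookup⇒[]=)
open import Data.Vec.Functional using (_++_)
open import Data.Vec.Functional.Properties using (lookup-++ˡ; lookup-++ʳ)
open import Function using (_∘_; const)
open import Relation.Binary.Definitions using (tri<; tri≈; tri>)
open import Relation.Binary.PropositionalEquality
open import Relation.Nullary using (Dec; yes; no; does; ¬_; contradiction)
open import Relation.Nullary.Decidable using (dec-true; dec-false; map′; _→-dec_; _⊎-dec_; _×-dec_)

does-true⇒ : ∀ {A : Set} (a? : Dec A) → does a? ≡ true → A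
does-true⇒ (yes a) _ = a

clash : ∀ {u} → u ≡ true → u ≡ false → ⊥
clash refl ()

∈-tabulate⁺ : ∀ {n} {p : Fin n → Bool} {q} → p q ≡ true → q ∈ tabulate p
∈-tabulate⁺ {p = p} {q} pq = lookup⇒[]= q _ (trans (lookup∘tabulate p q) pq)

∈-tabulate⁻ : ∀ {n} {p : Fin n → Bool} {q} → q ∈ tabulate p → p q ≡ true
∈-tabulate⁻ {p = p} {q} q∈ = trans (sym (lookup∘tabulate p q)) ([]=⇒lookup q∈)

member : ∀ {n} (S : Subset n) → Fin ∣ S ∣ → Fin n
member (true ∷ S) zero = zero
member (true ∷ S) (suc i) = suc (member S i)
member (false ∷ S) i = suc (member S i)

member-∈ : ∀ {n} (S : Subset n) i → member S i ∈ S
member-∈ (true ∷ S) zero = here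
member-∈ (true ∷ S) (suc i) = there (member-∈ S i)
member-∈ (false ∷ S) i = there (member-∈ S i)

member-injective : ∀ {n} (S : Subset n) {i j} → member S i ≡ member S j → i ≡ j
member-injective (true ∷ S) {zero} {zero} _ = refl
member-injective (true ∷ S) {suc i} {suc j} e = cong suc (member-injective S (Finₚ.suc-injective e))
member-injective (false ∷ S) e = member-injective S (Finₚ.suc-injective e)

rank : ∀ {n} {S : Subset n} {q} → q ∈ S → Fin ∣ S ∣
rank {S = true ∷ S} here = zero
rank {S = true ∷ S} (there q∈S) = suc (rank q∈S)
rank {S = false ∷ S} (there q∈S) = rank q∈S

member-rank : ∀ {n} {S : Subset n} {q} (q∈S : q ∈ S) → member S (rank q∈S) ≡ q
member-rank {S = true ∷ S} here = refl
member-rank {S = true ∷ S} (there q∈S) = cong suc (member-rank q∈S)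
member-rank {S = false ∷ S} (there q∈S) = cong suc (member-rank q∈S)

injective-into⇒≤∣∣ : ∀ {n c} (S : Subset n) (h : Fin c → Fin n) →
  (∀ {i j} → h i ≡ h j → i ≡ j) → (∀ i → h i ∈ S) → c ≤ ∣ S ∣
injective-into⇒≤∣∣ S h h-inj h∈S = injective⇒≤ {f = λ i → rank (h∈S i)} λ {i} {j} e →
  h-inj (trans (sym (member-rank (h∈S i))) (trans (cong (member S) e) (member-rank (h∈S j))))

injective-below⇒∣∣≤ : ∀ {n} c (S : Subset n) (g : ∀ q → q ∈ S → ℕ) → (∀ {q} (q∈S : q ∈ S) → g q q∈S < c) →
  (∀ {q q′} (q∈S : q ∈ S) (q′∈S : q′ ∈ S) → g q q∈S ≡ g q′ q′∈S → q ≡ q′) → ∣ S ∣ ≤ c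
injective-below⇒∣∣≤ c S g g<c g-inj = injective⇒≤ {f = λ i → fromℕ< (g<c (member-∈ S i))} λ {i} {j} e →
  member-injective S (g-inj (member-∈ S i) (member-∈ S j)
    (trans (sym (toℕ-fromℕ< _)) (trans (cong toℕ e) (toℕ-fromℕ< _))))

data SplitView (m n : ℕ) : Fin (m + n) → Set where
  left : ∀ i → SplitView m n (i ↑ˡ n)
  right : ∀ j → SplitView m n (m ↑ʳ j)

splitView : ∀ m {n} (q : Fin (m + n)) → SplitView m n q
splitView m q with splitAt m q in eq
... | inj₁ i = subst (SplitView m _) (splitAt⁻¹-↑ˡ eq) (left i)
... | inj₂ j = subst (SplitView m _) (splitAt⁻¹-↑ʳ eq) (right j)

++-injective : ∀ {A : Set} {m n} (f : Fin m → A) (g : Fin n → A) →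
  (∀ {i j} → f i ≡ f j → i ≡ j) → (∀ {i j} → g i ≡ g j → i ≡ j) → (∀ i j → f i ≢ g j) →
  ∀ {q q′} → (f ++ g) q ≡ (f ++ g) q′ → q ≡ q′
++-injective {m = m} {n} f g f-inj g-inj f≢g {q} {q′} e with splitView m q | splitView m q′
... | left i | left i′ = cong (_↑ˡ n) (f-inj (trans (sym (lookup-++ˡ f g i)) (trans e (lookup-++ˡ f g i′))))
... | right j | right j′ = cong (m ↑ʳ_) (g-inj (trans (sym (lookup-++ʳ f g j)) (trans e (lookup-++ʳ f g j′))))
... | left i | right j′ = ⊥-elim (f≢g i j′ (trans (sym (lookup-++ˡ f g i)) (trans e (lookup-++ʳ f g j′))))
... | right j | left i′ = ⊥-elim (f≢g i′ j (trans (sym (lookup-++ˡ f g i′)) (trans (sym e) (lookup-++ʳ f g j))))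

module _ {n : ℕ} where

  flipS-∉ : ∀ (x : Vec Bool n) {S q} → q ∉ S → lookup (flipS x S) q ≡ lookup x q
  flipS-∉ x {S} {q} q∉S = trans (lookup-zipWith _xor_ q x S)
    (trans (cong (lookup x q xor_) (¬-not λ e → q∉S (lookup⇒[]= q S e))) (xor-identityʳ (lookup x q)))

  flipS-∈ : ∀ (x : Vec Bool n) {S q} → q ∈ S → lookup (flipS x S) q ≡ not (lookup x q)
  flipS-∈ x {S} {q} q∈S = trans (lookup-zipWith _xor_ q x S)
    (trans (cong (lookup x q xor_) ([]=⇒lookup q∈S)) (xor-comm (lookup x q) true))

  flip-other : ∀ (x : Vec Bool n) {i q} → q ≢ i → lookup (flipS x ⁅ i ⁆) q ≡ lookup x q
  flip-other x {i} q≢i = flipS-∉ x (λ q∈⁅i⁆ → q≢i (x∈⁅y⁆⇒x≡y i q∈⁅i⁆))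

  flip-self : ∀ (x : Vec Bool n) i → lookup (flipS x ⁅ i ⁆) i ≡ not (lookup x i)
  flip-self x i = flipS-∈ x (x∈⁅x⁆ i)

  ⁅⁆-disjoint : ∀ {q q′ : Fin n} → q ≢ q′ → ∀ z → z ∈ ⁅ q ⁆ → z ∉ ⁅ q′ ⁆
  ⁅⁆-disjoint {q} {q′} q≢q′ z z∈q z∈q′ = q≢q′ (trans (sym (x∈⁅y⁆⇒x≡y q z∈q)) (x∈⁅y⁆⇒x≡y q′ z∈q′))

  flipped-where-differ : ∀ (x : Vec Bool n) q q′ z →
    lookup (flipS x ⁅ q ⁆) z ≢ lookup (flipS x ⁅ q′ ⁆) z → z ≡ q ⊎ z ≡ q′
  flipped-where-differ x q q′ z differ with z Fin.≟ q | z Fin.≟ q′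
  ... | yes z≡q | _ = inj₁ z≡q
  ... | no _ | yes z≡q′ = inj₂ z≡q′
  ... | no z≢q | no z≢q′ = ⊥-elim (differ (trans (flip-other x z≢q) (sym (flip-other x z≢q′))))

  sensitive : BoolFun n → Vec Bool n → Subset n
  sensitive f x = tabulate (λ i → f x xor f (flipS x ⁅ i ⁆))

  ∈-sensitive⁺ : ∀ {f : BoolFun n} {x i} → f (flipS x ⁅ i ⁆) ≢ f x → i ∈ sensitive f x
  ∈-sensitive⁺ {f} {x} flips = ∈-tabulate⁺ (trans (cong (f x xor_) (¬-not flips)) (xor-inverseʳ (f x)))

  ∈-sensitive⁻ : ∀ {f : BoolFun n} {x i} → i ∈ sensitive f x → f (flipS x ⁅ i ⁆) ≢ f x
  ∈-sensitive⁻ {f} {x} i∈ e = clash (∈-tabulate⁻ i∈) (trans (cong (f x xor_) e) (xor-same (f x)))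

  sensitive-∈-certificate : ∀ {f : BoolFun n} {x S} i →
    IsCertFor f x S → f (flipS x ⁅ i ⁆) ≢ f x → i ∈ S
  sensitive-∈-certificate {x = x} {S} i cert flips with i ∈? S
  ... | yes i∈S = i∈S
  ... | no i∉S = ⊥-elim (flips (cert _ λ q q∈S → flip-other x λ { refl → i∉S q∈S }))

module Terms {n k : ℕ} (dom : Fin k → Subset n) (value : Fin k → Vec Bool n) where

  record Sat (x : Vec Bool n) (j : Fin k) : Set where
    constructor agreeing
    field agrees : ∀ q → q ∈ dom j → lookup x q ≡ lookup (value j) q
  open Sat public

  sat? : ∀ x j → Dec (Sat x j)
  sat? x j = map′ agreeing agrees (all? λ q → q ∈? dom j →-dec lookup x q Bool.≟ lookup (value j) q)

  dnf : BoolFun n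
  dnf x = does (any? (sat? x))

  Sat⇒dnf-true : ∀ {x} j → Sat x j → dnf x ≡ true
  Sat⇒dnf-true {x} j s = dec-true (any? (sat? x)) (j , s)

  dnf-true⇒Sat : ∀ {x} → dnf x ≡ true → ∃ (Sat x)
  dnf-true⇒Sat {x} = does-true⇒ (any? (sat? x))

  unsat⇒dnf-false : ∀ {x} → (∀ j → ¬ Sat x j) → dnf x ≡ false
  unsat⇒dnf-false {x} unsat = dec-false (any? (sat? x)) λ (j , s) → unsat j s

  dnf-false⇒unsat : ∀ {x} → dnf x ≡ false → ∀ j → ¬ Sat x j
  dnf-false⇒unsat fx j s = clash (Sat⇒dnf-true j s) fx

  value-Sat : ∀ j → Sat (value j) j
  value-Sat j = agreeing λ q _ → refl

  Sat-flipS-disjoint : ∀ {x S S′ j} → (∀ q → q ∈ S → q ∉ S′) →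
    Sat (flipS x S) j → Sat (flipS x S′) j → Sat x j
  Sat-flipS-disjoint {x} {S} {j = j} disjoint sat-S sat-S′ = agreeing agree
    where
    agree : ∀ q → q ∈ dom j → lookup x q ≡ lookup (value j) q
    agree q q∈dom with q ∈? S
    ... | yes q∈S = trans (sym (flipS-∉ x (disjoint q q∈S))) (agrees sat-S′ q q∈dom)
    ... | no q∉S = trans (sym (flipS-∉ x q∉S)) (agrees sat-S q q∈dom)

  dom-certificate : ∀ {x j} → Sat x j → IsCertFor dnf x (dom j)
  dom-certificate {j = j} sat y agree =
    trans (Sat⇒dnf-true j (agreeing λ q q∈dom → trans (agree q q∈dom) (agrees sat q q∈dom))) (sym (Sat⇒dnf-true j sat))

  flips-to-true : ∀ {x y} → dnf x ≡ false → dnf y ≢ dnf x → dnf y ≡ true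
  flips-to-true fx flips = trans (¬-not flips) (cong not fx)

  blocks≤terms : ∀ {x b} → dnf x ≡ false → HasBlocks dnf x b → b ≤ k
  blocks≤terms {x} fx (B , disjoint , flips) = injective⇒≤ {f = λ i → proj₁ (satisfied i)} term-injective
    where
    satisfied : ∀ i → ∃ (Sat (flipS x (B i)))
    satisfied i = dnf-true⇒Sat (flips-to-true fx (flips i))

    term-injective : ∀ {i i′} → proj₁ (satisfied i) ≡ proj₁ (satisfied i′) → i ≡ i′
    term-injective {i} {i′} same with i Fin.≟ i′
    ... | yes i≡i′ = i≡i′
    ... | no i≢i′ = ⊥-elim (dnf-false⇒unsat fx _ (Sat-flipS-disjoint (disjoint i i′ i≢i′)
            (proj₂ (satisfied i)) (subst (Sat (flipS x (B i′))) (sym same) (proj₂ (satisfied i′)))))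

  value-blocks : (∀ {i j q} → q ∈ value i → q ∈ value j → i ≡ j) →
    dnf (replicate n false) ≡ false → HasBlocks dnf (replicate n false) k
  value-blocks overlap⇒≡ f0 =
    value , (λ i j i≢j q q∈i q∈j → i≢j (overlap⇒≡ q∈i q∈j)) ,
    λ j flips → clash (Sat⇒dnf-true j (flipped-zeros-Sat j)) (trans flips f0)
    where
    flipped-zeros-Sat : ∀ j → Sat (flipS (replicate n false) (value j)) j
    flipped-zeros-Sat j = agreeing λ q _ →
      trans (lookup-zipWith _xor_ q (replicate n false) (value j)) (cong (_xor lookup (value j) q) (lookup-replicate q false))

≤1+⌊n/2⌋+⌊n/2⌋ : ∀ n → n ≤ suc (⌊ n /2⌋ + ⌊ n /2⌋)
≤1+⌊n/2⌋+⌊n/2⌋ zero = z≤n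
≤1+⌊n/2⌋+⌊n/2⌋ (suc zero) = s≤s z≤n
≤1+⌊n/2⌋+⌊n/2⌋ (suc (suc n)) = s≤s (s≤s (≤-trans (≤1+⌊n/2⌋+⌊n/2⌋ n) (≤-reflexive (sym (+-suc _ _)))))

0<n⇒⌊n/2⌋<n : ∀ {n} → 0 < n → ⌊ n /2⌋ < n
0<n⇒⌊n/2⌋<n {suc n} _ = ⌊n/2⌋<n n

⌊[m+m]+n/2⌋≡m+⌊n/2⌋ : ∀ m n → ⌊ (m + m) + n /2⌋ ≡ m + ⌊ n /2⌋
⌊[m+m]+n/2⌋≡m+⌊n/2⌋ zero n = refl
⌊[m+m]+n/2⌋≡m+⌊n/2⌋ (suc m) n rewrite +-suc m m = cong suc (⌊[m+m]+n/2⌋≡m+⌊n/2⌋ m n)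

⌊3n/2⌋+1≡n+1+⌊n/2⌋ : ∀ n → ⌊ 3 * n /2⌋ + 1 ≡ n + suc ⌊ n /2⌋
⌊3n/2⌋+1≡n+1+⌊n/2⌋ n = begin
  ⌊ 3 * n /2⌋ + 1         ≡⟨ cong (λ s → ⌊ s /2⌋ + 1) (trans (cong (λ s → n + (n + s)) (+-identityʳ n)) (sym (+-assoc n n n))) ⟩
  ⌊ (n + n) + n /2⌋ + 1   ≡⟨ cong (_+ 1) (⌊[m+m]+n/2⌋≡m+⌊n/2⌋ n n) ⟩
  n + ⌊ n /2⌋ + 1         ≡⟨ +-assoc n _ 1 ⟩
  n + (⌊ n /2⌋ + 1)       ≡⟨ cong (n +_) (+-comm _ 1) ⟩
  n + suc ⌊ n /2⌋         ∎
  where open ≡-Reasoning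

module _ (k m : ℕ) .{{_ : NonZero m}} where

  private
    k+m∸1≡k+[m∸1] : k + m ∸ 1 ≡ k + (m ∸ 1)
    k+m∸1≡k+[m∸1] = +-∸-assoc k (>-nonZero⁻¹ m)

  ≤ceilDiv* : k ≤ ceilDiv k m * m
  ≤ceilDiv* = +-cancelʳ-≤ (m ∸ 1) k _ (begin
    k + (m ∸ 1)                                 ≡⟨ sym k+m∸1≡k+[m∸1] ⟩
    k + m ∸ 1                                   ≡⟨ m≡m%n+[m/n]*n (k + m ∸ 1) m ⟩
    (k + m ∸ 1) % m + ceilDiv k m * m           ≤⟨ +-monoˡ-≤ _ (<⇒≤pred (m%n<n (k + m ∸ 1) m)) ⟩
    pred m + ceilDiv k m * m                    ≡⟨ +-comm (pred m) _ ⟩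
    ceilDiv k m * m + (m ∸ 1)                   ∎)
    where open ≤-Reasoning

  <ceilDiv⇒*< : ∀ {p} → p < ceilDiv k m → p * m < k
  <ceilDiv⇒*< {p} p<t = +-cancelʳ-< m (p * m) k (begin-strict
    p * m + m            ≡⟨ +-comm (p * m) m ⟩
    suc p * m            ≤⟨ *-monoˡ-≤ m p<t ⟩
    ceilDiv k m * m      ≤⟨ m/n*n≤m (k + m ∸ 1) m ⟩
    k + m ∸ 1            ≡⟨ k+m∸1≡k+[m∸1] ⟩
    k + (m ∸ 1)          <⟨ +-monoʳ-< k (∸-monoʳ-< {m} z<s (>-nonZero⁻¹ m)) ⟩
    k + m                ∎)
    where open ≤-Reasoning

module Clockwise (t : ℕ) where

  half : ℕ
  half = ⌊ t /2⌋

  steps : ℕ → ℕ → ℕ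
  steps p q with p ≤? q
  ... | yes _ = q ∸ p
  ... | no _ = q + t ∸ p

  Near : ℕ → ℕ → Set
  Near p q = 1 ≤ steps p q × steps p q ≤ half

  near? : ∀ p q → Dec (Near p q)
  near? p q = 1 ≤? steps p q ×-dec steps p q ≤? half

  steps-≤ : ∀ {p q} → p ≤ q → steps p q ≡ q ∸ p
  steps-≤ {p} {q} p≤q with p ≤? q
  ... | yes _ = refl
  ... | no p≰q = contradiction p≤q p≰q

  steps-self : ∀ p → steps p p ≡ 0
  steps-self p = trans (steps-≤ {p} ≤-refl) (n∸n≡0 p)

  Near-if-≤half : ∀ {p q} → p < q → q ≤ half → Near p q
  Near-if-≤half {p} {q} p<q q≤half rewrite steps-≤ (<⇒≤ p<q) = m<n⇒0<n∸m p<q , ≤-trans (m∸n≤m q p) q≤half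

  steps-forward : ∀ {p q} → p ≤ q → steps p q + p ≡ q
  steps-forward p≤q rewrite steps-≤ p≤q = m∸n+n≡m p≤q

  steps-around : ∀ {p q} → q < p → p < t → steps p q + p ≡ q + t
  steps-around {p} {q} q<p p<t with p ≤? q
  ... | yes p≤q = contradiction p≤q (<⇒≱ q<p)
  ... | no _ = m∸n+n≡m (≤-trans (<⇒≤ p<t) (m≤n+m t q))

  steps-spec : ∀ {p} q → p < t → steps p q + p ≡ q ⊎ steps p q + p ≡ q + t
  steps-spec {p} q p<t = Sum.map steps-forward (λ q<p → steps-around q<p p<t) (≤-<-connex p q)

  private
    no-double-wrap : ∀ {d p p′ q} → p′ < t → d + p ≡ q → d + p′ ≡ q + t → ⊥
    no-double-wrap {d} {p} {p′} p′<t a b = <⇒≱ p′<t (subst (t ≤_) (sym p′≡p+t) (m≤n+m t p))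
      where
      p′≡p+t : p′ ≡ p + t
      p′≡p+t = +-cancelˡ-≡ d p′ (p + t) (trans b (trans (cong (_+ t) (sym a)) (+-assoc d p t)))

  steps-injectiveˡ : ∀ {p p′ q} → p < t → p′ < t → steps p q ≡ steps p′ q → p ≡ p′
  steps-injectiveˡ {p} {p′} {q} p<t p′<t e with steps-spec q p<t | steps-spec q p′<t
  ... | inj₁ a | inj₁ b = +-cancelˡ-≡ _ p p′ (trans a (sym (trans (cong (_+ p′) e) b)))
  ... | inj₂ a | inj₂ b = +-cancelˡ-≡ _ p p′ (trans a (sym (trans (cong (_+ p′) e) b)))
  ... | inj₁ a | inj₂ b = ⊥-elim (no-double-wrap p′<t a (trans (cong (_+ p′) e) b))
  ... | inj₂ a | inj₁ b = ⊥-elim (no-double-wrap p<t b (trans (cong (_+ p) (sym e)) a))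

  steps-sum : ∀ {p q} → p < q → q < t → steps p q + steps q p ≡ t
  steps-sum {p} {q} p<q q<t = +-cancelʳ-≡ q _ t (begin
    steps p q + steps q p + q      ≡⟨ +-assoc (steps p q) _ q ⟩
    steps p q + (steps q p + q)    ≡⟨ cong (steps p q +_) (steps-around p<q q<t) ⟩
    steps p q + (p + t)            ≡⟨ sym (+-assoc (steps p q) p t) ⟩
    steps p q + p + t              ≡⟨ cong (_+ t) (steps-forward (<⇒≤ p<q)) ⟩
    q + t                          ≡⟨ +-comm q t ⟩
    t + q                          ∎)
    where open ≡-Reasoning

  private
    Near-total-< : ∀ {p q} → p < q → q < t → Near p q ⊎ Near q p
    Near-total-< {p} {q} p<q q<t with steps p q ≤? half
    ... | yes ahead = inj₁ (subst (1 ≤_) (sym (steps-≤ (<⇒≤ p<q))) (m<n⇒0<n∸m p<q) , ahead)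
    ... | no behind = inj₂ (n≢0⇒n>0 back≢0 , +-cancelˡ-≤ (suc half) _ half (begin
          suc half + steps q p        ≤⟨ +-monoˡ-≤ (steps q p) (≰⇒> behind) ⟩
          steps p q + steps q p       ≡⟨ steps-sum p<q q<t ⟩
          t                           ≤⟨ ≤1+⌊n/2⌋+⌊n/2⌋ t ⟩
          suc half + half             ∎))
      where
      open ≤-Reasoning
      back≢0 : steps q p ≢ 0
      back≢0 back≡0 = <⇒≱ q<t (begin
        t                         ≡⟨ sym (steps-sum p<q q<t) ⟩
        steps p q + steps q p     ≡⟨ cong (steps p q +_) back≡0 ⟩
        steps p q + 0             ≡⟨ +-identityʳ _ ⟩
        steps p q                 ≡⟨ steps-≤ (<⇒≤ p<q) ⟩
        q ∸ p                     ≤⟨ m∸n≤m q p ⟩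
        q                         ∎)

  Near-total : ∀ {p q} → p ≢ q → p < t → q < t → Near p q ⊎ Near q p
  Near-total {p} {q} p≢q p<t q<t with <-cmp p q
  ... | tri< p<q _ _ = Near-total-< p<q q<t
  ... | tri≈ _ p≡q _ = contradiction p≡q p≢q
  ... | tri> _ _ q<p = Sum.swap (Near-total-< q<p p<t)

module Construction (m k : ℕ) .{{_ : NonZero m}} (m≤k : m ≤ k) where

  t : ℕ
  t = ceilDiv k m

  open Clockwise t

  0<t : 0 < t
  0<t = n≢0⇒n>0 λ t≡0 → <⇒≱ (≤-trans (>-nonZero⁻¹ m) m≤k) (subst (λ s → k ≤ s * m) t≡0 (≤ceilDiv* k m))

  half<t : half < t
  half<t = 0<n⇒⌊n/2⌋<n 0<t

  group position : Fin k → ℕ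
  group l = toℕ l % m
  position l = toℕ l / m

  position<t : ∀ l → position l < t
  position<t l = m<n*o⇒m/o<n (<-≤-trans (toℕ<n l) (≤ceilDiv* k m))

  cell-injective : ∀ {l l′} → group l ≡ group l′ → position l ≡ position l′ → l ≡ l′
  cell-injective {l} {l′} g≡ p≡ = toℕ-injective (begin
    toℕ l                        ≡⟨ m≡m%n+[m/n]*n (toℕ l) m ⟩
    group l + position l * m     ≡⟨ cong₂ (λ u v → u + v * m) g≡ p≡ ⟩
    group l′ + position l′ * m   ≡⟨ sym (m≡m%n+[m/n]*n (toℕ l′) m) ⟩
    toℕ l′                       ∎)
    where open ≡-Reasoning

  -- Group 0 is full: every position p < t has the cell p * m < k.
  column : Fin t → Fin k
  column p = fromℕ< (<ceilDiv⇒*< k m (toℕ<n p))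

  group-column : ∀ p → group (column p) ≡ 0
  group-column p rewrite toℕ-fromℕ< (<ceilDiv⇒*< k m (toℕ<n p)) = m*n%n≡0 (toℕ p) m

  position-column : ∀ p → position (column p) ≡ toℕ p
  position-column p rewrite toℕ-fromℕ< (<ceilDiv⇒*< k m (toℕ<n p)) = m*n/n≡m (toℕ p) m

  column-injective : ∀ {p p′} → column p ≡ column p′ → p ≡ p′
  column-injective {p} {p′} e =
    toℕ-injective (trans (sym (position-column p)) (trans (cong position e) (position-column p′)))

  firstRow : Fin m → Fin k
  firstRow g = inject≤ g m≤k

  position-firstRow : ∀ g → position (firstRow g) ≡ 0
  position-firstRow g rewrite toℕ-inject≤ g m≤k = m<n⇒m/n≡0 (toℕ<n g)

  Close : Fin k → Fin k → Set
  Close l j = group l ≡ group j × Near (position l) (position j)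

  close? : ∀ l j → Dec (Close l j)
  close? l j = group l ≟ group j ×-dec near? (position l) (position j)

  N : ℕ
  N = k + k

  a b : Fin k → Fin N
  a l = l ↑ˡ k
  b l = k ↑ʳ l

  a≢b : ∀ {l l′} → a l ≢ b l′
  a≢b {l} {l′} e = <⇒≱ (subst (_< k) (sym (toℕ-↑ˡ l k)) (toℕ<n l))
    (subst (k ≤_) (trans (sym (toℕ-↑ʳ k l′)) (cong toℕ (sym e))) (m≤m+n k (toℕ l′)))

  b-injective : ∀ {l l′} → b l ≡ b l′ → l ≡ l′
  b-injective = ↑ʳ-injective k _ _

  fixes-a? : ∀ j l → Dec (l ≡ j ⊎ Close l j)
  fixes-a? j l = l Fin.≟ j ⊎-dec close? l j

  fixes-b? : ∀ j l → Dec (group l ≡ group j)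
  fixes-b? j l = group l ≟ group j

  dom : Fin k → Subset N
  dom j = tabulate ((does ∘ fixes-a? j) ++ (does ∘ fixes-b? j))

  indicator : Fin k → Fin k → Bool
  indicator j l = does (l Fin.≟ j)

  value : Fin k → Vec Bool N
  value j = tabulate (indicator j ++ indicator j)

  private
    lookup-dom-a : ∀ j l → lookup (dom j) (a l) ≡ does (fixes-a? j l)
    lookup-dom-a j l = trans (lookup∘tabulate _ (a l)) (lookup-++ˡ (does ∘ fixes-a? j) (does ∘ fixes-b? j) l)

    lookup-dom-b : ∀ j l → lookup (dom j) (b l) ≡ does (fixes-b? j l)
    lookup-dom-b j l = trans (lookup∘tabulate _ (b l)) (lookup-++ʳ (does ∘ fixes-a? j) (does ∘ fixes-b? j) l)

  a∈dom⁺ : ∀ {j l} → l ≡ j ⊎ Close l j → a l ∈ dom j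
  a∈dom⁺ {j} {l} fixed = lookup⇒[]= _ _ (trans (lookup-dom-a j l) (dec-true (fixes-a? j l) fixed))

  a∈dom⁻ : ∀ {j l} → a l ∈ dom j → l ≡ j ⊎ Close l j
  a∈dom⁻ {j} {l} a∈ = does-true⇒ (fixes-a? j l) (trans (sym (lookup-dom-a j l)) ([]=⇒lookup a∈))

  b∈dom⁺ : ∀ {j l} → group l ≡ group j → b l ∈ dom j
  b∈dom⁺ {j} {l} same = lookup⇒[]= _ _ (trans (lookup-dom-b j l) (dec-true (fixes-b? j l) same))

  b∈dom⁻ : ∀ {j l} → b l ∈ dom j → group l ≡ group j
  b∈dom⁻ {j} {l} b∈ = does-true⇒ (fixes-b? j l) (trans (sym (lookup-dom-b j l)) ([]=⇒lookup b∈))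

  value-a : ∀ j l → lookup (value j) (a l) ≡ does (l Fin.≟ j)
  value-a j l = trans (lookup∘tabulate _ (a l)) (lookup-++ˡ (indicator j) (indicator j) l)

  value-b : ∀ j l → lookup (value j) (b l) ≡ does (l Fin.≟ j)
  value-b j l = trans (lookup∘tabulate _ (b l)) (lookup-++ʳ (indicator j) (indicator j) l)

  value-a-≢ : ∀ {j l} → l ≢ j → lookup (value j) (a l) ≡ false
  value-a-≢ {j} {l} l≢j = trans (value-a j l) (dec-false (l Fin.≟ j) l≢j)

  value-b-≢ : ∀ {j l} → l ≢ j → lookup (value j) (b l) ≡ false
  value-b-≢ {j} {l} l≢j = trans (value-b j l) (dec-false (l Fin.≟ j) l≢j)

  value-a-self : ∀ j → lookup (value j) (a j) ≡ true
  value-a-self j = trans (value-a j j) (dec-true (j Fin.≟ j) refl)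

  value-b-self : ∀ j → lookup (value j) (b j) ≡ true
  value-b-self j = trans (value-b j j) (dec-true (j Fin.≟ j) refl)

  open Terms dom value public renaming (dnf to f)

  record Pattern (x : Vec Bool N) (j : Fin k) : Set where
    field
      a-on : lookup x (a j) ≡ true
      b-on : lookup x (b j) ≡ true
      b-off : ∀ {l} → l ≢ j → group l ≡ group j → lookup x (b l) ≡ false
      a-off : ∀ {l} → l ≢ j → Close l j → lookup x (a l) ≡ false
  open Pattern

  Sat⇒Pattern : ∀ {x j} → Sat x j → Pattern x j
  Sat⇒Pattern {j = j} s = record
    { a-on = trans (agrees s (a j) (a∈dom⁺ (inj₁ refl))) (value-a-self j)
    ; b-on = trans (agrees s (b j) (b∈dom⁺ refl)) (value-b-self j)
    ; b-off = λ l≢j same → trans (agrees s _ (b∈dom⁺ same)) (value-b-≢ l≢j)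
    ; a-off = λ l≢j close → trans (agrees s _ (a∈dom⁺ (inj₂ close))) (value-a-≢ l≢j)
    }

  fixed-a⇒Close : ∀ {j l} → l ≢ j → l ≡ j ⊎ Close l j → Close l j
  fixed-a⇒Close l≢j = Sum.[ (λ l≡j → contradiction l≡j l≢j) , (λ close → close) ]

  Pattern⇒Sat : ∀ {x j} → Pattern x j → Sat x j
  Pattern⇒Sat {x} {j} pat = agreeing agree
    where
    agree : ∀ q → q ∈ dom j → lookup x q ≡ lookup (value j) q
    agree q q∈ with splitView k q
    ... | left l with l Fin.≟ j
    ...   | yes refl = trans (a-on pat) (sym (value-a-self j))
    ...   | no l≢j = trans (a-off pat l≢j (fixed-a⇒Close l≢j (a∈dom⁻ q∈))) (sym (value-a-≢ l≢j))
    agree q q∈ | right l with l Fin.≟ j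
    ...   | yes refl = trans (b-on pat) (sym (value-b-self j))
    ...   | no l≢j = trans (b-off pat l≢j (b∈dom⁻ q∈)) (sym (value-b-≢ l≢j))

  Pattern⇒f-true : ∀ {x j} → Pattern x j → f x ≡ true
  Pattern⇒f-true pat = Sat⇒dnf-true _ (Pattern⇒Sat pat)

  f-true⇒Pattern : ∀ {x} → f x ≡ true → ∃ (Pattern x)
  f-true⇒Pattern fx = let (j , s) = dnf-true⇒Sat fx in j , Sat⇒Pattern s

  no-Pattern⇒f-false : ∀ {x} → (∀ j → ¬ Pattern x j) → f x ≡ false
  no-Pattern⇒f-false none = unsat⇒dnf-false λ j s → none j (Sat⇒Pattern s)

  all-b-off⇒f-false : ∀ {x} → (∀ l → lookup x (b l) ≡ false) → f x ≡ false
  all-b-off⇒f-false off = no-Pattern⇒f-false λ j pat → clash (b-on pat) (off j)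

  a-unflipped-by-two-b : ∀ {l l′ q q′} → l ≢ l′ → b l ≡ q ⊎ b l ≡ q′ → b l′ ≡ q ⊎ b l′ ≡ q′ →
    ∀ i → a i ≢ q × a i ≢ q′
  a-unflipped-by-two-b l≢l′ (inj₁ e) (inj₁ e′) = ⊥-elim (l≢l′ (b-injective (trans e (sym e′))))
  a-unflipped-by-two-b l≢l′ (inj₂ e) (inj₂ e′) = ⊥-elim (l≢l′ (b-injective (trans e (sym e′))))
  a-unflipped-by-two-b l≢l′ (inj₁ refl) (inj₂ refl) i = a≢b , a≢b
  a-unflipped-by-two-b l≢l′ (inj₂ refl) (inj₁ refl) i = a≢b , a≢b

  b-flipped : ∀ {x q q′ j j′} → j ≢ j′ → group j ≡ group j′ →
    Pattern (flipS x ⁅ q ⁆) j → Pattern (flipS x ⁅ q′ ⁆) j′ → b j ≡ q ⊎ b j ≡ q′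
  b-flipped {x} {q} {q′} {j} j≢j′ same pat pat′ =
    flipped-where-differ x q q′ (b j) λ e → clash (trans (sym e) (b-on pat)) (b-off pat′ j≢j′ same)

  -- Flips completing two distinct terms of one group must be their b-variables, so both
  -- a-variables survive from x; but the later term forbids the a-variable of the earlier one.
  same-group⇒not-Near : ∀ {x q q′ j j′} → j ≢ j′ → group j ≡ group j′ →
    Pattern (flipS x ⁅ q ⁆) j → Pattern (flipS x ⁅ q′ ⁆) j′ → ¬ Near (position j) (position j′)
  same-group⇒not-Near {x} {q} {q′} {j} j≢j′ same pat pat′ near = clash (a-on pat) (begin
    lookup (flipS x ⁅ q ⁆) (a j)    ≡⟨ flip-other x (proj₁ (unflipped j)) ⟩
    lookup x (a j)                  ≡⟨ sym (flip-other x (proj₂ (unflipped j))) ⟩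
    lookup (flipS x ⁅ q′ ⁆) (a j)   ≡⟨ a-off pat′ j≢j′ (same , near) ⟩
    false                           ∎)
    where
    open ≡-Reasoning
    unflipped : ∀ i → a i ≢ q × a i ≢ q′
    unflipped = a-unflipped-by-two-b j≢j′ (b-flipped j≢j′ same pat pat′)
      (Sum.swap (b-flipped (λ e → j≢j′ (sym e)) (sym same) pat′ pat))

  flips-in-same-group : ∀ {x q q′ j j′} → f x ≡ false →
    Pattern (flipS x ⁅ q ⁆) j → Pattern (flipS x ⁅ q′ ⁆) j′ → group j ≡ group j′ → q ≡ q′
  flips-in-same-group {x} {q} {q′} {j} {j′} fx pat pat′ same with q Fin.≟ q′ | j Fin.≟ j′
  ... | yes q≡q′ | _ = q≡q′
  ... | no _ | no j≢j′ = ⊥-elim (Sum.[ same-group⇒not-Near j≢j′ same pat pat′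
                                     , same-group⇒not-Near (λ e → j≢j′ (sym e)) (sym same) pat′ pat ]
        (Near-total (λ e → j≢j′ (cell-injective same e)) (position<t j) (position<t j′)))
  ... | no q≢q′ | yes refl = ⊥-elim (dnf-false⇒unsat fx j
        (Sat-flipS-disjoint (⁅⁆-disjoint q≢q′) (Pattern⇒Sat pat) (Pattern⇒Sat pat′)))

  flip-Pattern : ∀ {x q} → f x ≡ false → q ∈ sensitive f x → ∃ (Pattern (flipS x ⁅ q ⁆))
  flip-Pattern {x} fx q∈ = f-true⇒Pattern (flips-to-true fx (∈-sensitive⁻ {f = f} {x} q∈))

  sensitivity₀≤m : ∀ {x} → f x ≡ false → sens f x ≤ m
  sensitivity₀≤m {x} fx = injective-below⇒∣∣≤ m (sensitive f x)
    (λ _ q∈ → group (proj₁ (flip-Pattern fx q∈))) (λ _ → m%n<n _ m)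
    λ q∈ q′∈ → flips-in-same-group fx (proj₂ (flip-Pattern fx q∈)) (proj₂ (flip-Pattern fx q′∈))

  first : Fin k → Bool
  first l = does (position l ≟ 0)

  x₀ : Vec Bool N
  x₀ = tabulate (first ++ const false)

  x₀-a : ∀ l → lookup x₀ (a l) ≡ first l
  x₀-a l = trans (lookup∘tabulate _ (a l)) (lookup-++ˡ first (const false) l)

  x₀-b : ∀ l → lookup x₀ (b l) ≡ false
  x₀-b l = trans (lookup∘tabulate _ (b l)) (lookup-++ʳ first (const false) l)

  f-x₀ : f x₀ ≡ false
  f-x₀ = all-b-off⇒f-false x₀-b

  firstRow-flip-Pattern : ∀ g → Pattern (flipS x₀ ⁅ b (firstRow g) ⁆) (firstRow g)
  firstRow-flip-Pattern g = record
    { a-on = trans (flip-other x₀ a≢b) (trans (x₀-a l) (dec-true (_ ≟ 0) (position-firstRow g)))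
    ; b-on = trans (flip-self x₀ (b l)) (cong not (x₀-b l))
    ; b-off = λ l′≢l _ → trans (flip-other x₀ (λ e → l′≢l (b-injective e))) (x₀-b _)
    ; a-off = λ {l′} l′≢l (same , _) → trans (flip-other x₀ a≢b) (trans (x₀-a l′) (dec-false (_ ≟ 0)
        λ starts → l′≢l (cell-injective same (trans starts (sym (position-firstRow g))))))
    }
    where
    l = firstRow g

  m≤sensitivity-x₀ : m ≤ sens f x₀
  m≤sensitivity-x₀ = injective-into⇒≤∣∣ (sensitive f x₀) (b ∘ firstRow)
    (λ e → inject≤-injective _ _ _ _ (b-injective e))
    λ g → ∈-sensitive⁺ {f = f} {x₀} λ e → clash (Pattern⇒f-true (firstRow-flip-Pattern g)) (trans e f-x₀)

  sensitivity₀ : IsSensZ f false m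
  sensitivity₀ = (x₀ , f-x₀ , ≤-antisym (sensitivity₀≤m f-x₀) m≤sensitivity-x₀) , λ _ → sensitivity₀≤m

  private
    a∈value⇒≡ : ∀ {j l} → a l ∈ value j → l ≡ j
    a∈value⇒≡ {j} {l} a∈ = does-true⇒ (l Fin.≟ j) (trans (sym (value-a j l)) ([]=⇒lookup a∈))

    b∈value⇒≡ : ∀ {j l} → b l ∈ value j → l ≡ j
    b∈value⇒≡ {j} {l} b∈ = does-true⇒ (l Fin.≟ j) (trans (sym (value-b j l)) ([]=⇒lookup b∈))

  value-overlap : ∀ {i j q} → q ∈ value i → q ∈ value j → i ≡ j
  value-overlap {q = q} q∈i q∈j with splitView k q
  ... | left l = trans (sym (a∈value⇒≡ q∈i)) (a∈value⇒≡ q∈j)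
  ... | right l = trans (sym (b∈value⇒≡ q∈i)) (b∈value⇒≡ q∈j)

  f-zeros : f (replicate N false) ≡ false
  f-zeros = all-b-off⇒f-false λ l → lookup-replicate (b l) false

  block-sensitivity₀ : IsBsZ f false k
  block-sensitivity₀ = (replicate N false , f-zeros , value-blocks value-overlap f-zeros) ,
    λ _ fx _ → blocks≤terms fx

  a-weight : Fin k → Fin k → ℕ
  a-weight j l = t + steps (position l) (position j)

  weight : Fin k → Fin N → ℕ
  weight j = a-weight j ++ position

  private
    weight-a : ∀ j l → weight j (a l) ≡ a-weight j l
    weight-a j l = lookup-++ˡ (a-weight j) position l

    weight-b : ∀ j l → weight j (b l) ≡ position l
    weight-b j l = lookup-++ʳ (a-weight j) position l

    fixed-a-group : ∀ {j l} → l ≡ j ⊎ Close l j → group l ≡ group j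
    fixed-a-group (inj₁ refl) = refl
    fixed-a-group (inj₂ (same , _)) = same

    fixed-a-steps : ∀ {j l} → l ≡ j ⊎ Close l j → steps (position l) (position j) ≤ half
    fixed-a-steps {j} (inj₁ refl) = subst (_≤ half) (sym (steps-self (position j))) z≤n
    fixed-a-steps (inj₂ (_ , _ , near)) = near

  weight< : ∀ {j q} → q ∈ dom j → weight j q < t + suc half
  weight< {j} {q} q∈ with splitView k q
  ... | left l rewrite weight-a j l = +-monoʳ-< t (s≤s (fixed-a-steps (a∈dom⁻ q∈)))
  ... | right l rewrite weight-b j l = <-≤-trans (position<t l) (m≤m+n t (suc half))

  weight-injective : ∀ {j q q′} → q ∈ dom j → q′ ∈ dom j → weight j q ≡ weight j q′ → q ≡ q′
  weight-injective {j} {q} {q′} q∈ q′∈ e with splitView k q | splitView k q′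
  ... | left l | left l′ rewrite weight-a j l | weight-a j l′ =
    cong a (cell-injective (trans (fixed-a-group (a∈dom⁻ q∈)) (sym (fixed-a-group (a∈dom⁻ q′∈))))
      (steps-injectiveˡ (position<t l) (position<t l′) (+-cancelˡ-≡ t _ _ e)))
  ... | right l | right l′ rewrite weight-b j l | weight-b j l′ =
    cong b (cell-injective (trans (b∈dom⁻ q∈) (sym (b∈dom⁻ q′∈))) e)
  ... | left l | right l′ rewrite weight-a j l | weight-b j l′ =
    ⊥-elim (<⇒≱ (position<t l′) (≤-trans (m≤m+n t _) (≤-reflexive e)))
  ... | right l | left l′ rewrite weight-b j l | weight-a j l′ =
    ⊥-elim (<⇒≱ (position<t l) (≤-trans (m≤m+n t _) (≤-reflexive (sym e))))

  ∣dom∣≤ : ∀ j → ∣ dom j ∣ ≤ t + suc half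
  ∣dom∣≤ j = injective-below⇒∣∣≤ _ (dom j) (λ q _ → weight j q) weight< weight-injective

  certificate₁≤ : ∀ {x c} → f x ≡ true → IsCertCx f x c → c ≤ t + suc half
  certificate₁≤ fx (_ , minimal) =
    let (j , s) = dnf-true⇒Sat fx in ≤-trans (minimal (dom j) (dom-certificate s)) (∣dom∣≤ j)

  f-value : ∀ c → f (value c) ≡ true
  f-value c = Sat⇒dnf-true c (value-Sat c)

  b-flip-unsat : ∀ {c l} → group l ≡ group c → ∀ j → ¬ Pattern (flipS (value c) ⁅ b l ⁆) j
  b-flip-unsat {c} {l} same j pat with j Fin.≟ c | l Fin.≟ c
  ... | yes refl | yes refl = clash (b-on pat) (trans (flip-self (value c) (b c)) (cong not (value-b-self c)))
  ... | yes refl | no l≢c = clash (trans (flip-self (value c) (b l)) (cong not (value-b-≢ l≢c))) (b-off pat l≢c same)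
  ... | no j≢c | _ with j Fin.≟ l
  ...   | yes refl = clash (a-on pat) (trans (flip-other (value c) a≢b) (value-a-≢ j≢c))
  ...   | no j≢l = clash (b-on pat) (trans (flip-other (value c) (λ e → j≢l (b-injective e))) (value-b-≢ j≢c))

  a-flip-unsat : ∀ {c l} → l ≡ c ⊎ Close l c → ∀ j → ¬ Pattern (flipS (value c) ⁅ a l ⁆) j
  a-flip-unsat {c} {l} fixed j pat with j Fin.≟ c
  ... | no j≢c = clash (b-on pat) (trans (flip-other (value c) (λ e → a≢b (sym e))) (value-b-≢ j≢c))
  ... | yes refl with l Fin.≟ c
  ...   | yes refl = clash (a-on pat) (trans (flip-self (value c) (a c)) (cong not (value-a-self c)))
  ...   | no l≢c = clash (trans (flip-self (value c) (a l)) (cong not (value-a-≢ l≢c)))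
                         (a-off pat l≢c (fixed-a⇒Close l≢c fixed))

  flip-fixed-falsifies : ∀ {c q} → q ∈ dom c → f (flipS (value c) ⁅ q ⁆) ≡ false
  flip-fixed-falsifies {q = q} q∈ with splitView k q
  ... | left l = no-Pattern⇒f-false (a-flip-unsat (a∈dom⁻ q∈))
  ... | right l = no-Pattern⇒f-false (b-flip-unsat (b∈dom⁻ q∈))

  ∣dom∣≤certificate : ∀ c S → IsCertFor f (value c) S → ∣ dom c ∣ ≤ ∣ S ∣
  ∣dom∣≤certificate c S cert = p⊆q⇒∣p∣≤∣q∣ λ {q} q∈ →
    sensitive-∈-certificate q cert λ e → clash (f-value c) (trans (sym e) (flip-fixed-falsifies q∈))

  certificate-value : ∀ c → IsCertCx f (value c) ∣ dom c ∣
  certificate-value c = (dom c , dom-certificate (value-Sat c) , refl) , ∣dom∣≤certificate c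

  -- At position ⌊t/2⌋, all earlier positions are within half a turn without wrapping around.
  apex : Fin k
  apex = column (fromℕ< half<t)

  group-apex : group apex ≡ 0
  group-apex = group-column (fromℕ< half<t)

  position-apex : position apex ≡ half
  position-apex = trans (position-column (fromℕ< half<t)) (toℕ-fromℕ< half<t)

  low-column : Fin (suc half) → Fin k
  low-column u = column (inject≤ u half<t)

  position-low-column : ∀ u → position (low-column u) ≤ half
  position-low-column u =
    subst (_≤ half) (sym (trans (position-column (inject≤ u half<t)) (toℕ-inject≤ u half<t))) (s≤s⁻¹ (toℕ<n u))

  fixed-if-before : ∀ {c l} → group l ≡ group c → position l ≤ position c → position c ≤ half → l ≡ c ⊎ Close l c
  fixed-if-before {c} {l} same before c≤half with l Fin.≟ c
  ... | yes l≡c = inj₁ l≡c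
  ... | no l≢c = inj₂ (same , Near-if-≤half (≤∧≢⇒< before (λ e → l≢c (cell-injective same e))) c≤half)

  apex-dom : Fin (t + suc half) → Fin N
  apex-dom = (b ∘ column) ++ (a ∘ low-column)

  apex-dom-∈ : ∀ i → apex-dom i ∈ dom apex
  apex-dom-∈ i with splitView t i
  ... | left p = subst (_∈ dom apex) (sym (lookup-++ˡ (b ∘ column) (a ∘ low-column) p))
    (b∈dom⁺ (trans (group-column p) (sym group-apex)))
  ... | right u = subst (_∈ dom apex) (sym (lookup-++ʳ (b ∘ column) (a ∘ low-column) u))
    (a∈dom⁺ (fixed-if-before (trans (group-column (inject≤ u half<t)) (sym group-apex))
      (subst (position (low-column u) ≤_) (sym position-apex) (position-low-column u)) (≤-reflexive position-apex)))

  apex-dom-injective : ∀ {i i′} → apex-dom i ≡ apex-dom i′ → i ≡ i′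
  apex-dom-injective = ++-injective (b ∘ column) (a ∘ low-column)
    (column-injective ∘ b-injective)
    (λ e → inject≤-injective _ _ _ _ (column-injective (↑ˡ-injective k _ _ e)))
    λ _ _ e → a≢b (sym e)

  ∣dom-apex∣ : ∣ dom apex ∣ ≡ t + suc half
  ∣dom-apex∣ = ≤-antisym (∣dom∣≤ apex) (injective-into⇒≤∣∣ (dom apex) apex-dom apex-dom-injective apex-dom-∈)

  certificate₁ : IsCertZ f true (t + suc half)
  certificate₁ = (value apex , f-value apex , subst (IsCertCx f (value apex)) ∣dom-apex∣ (certificate-value apex)) ,
    λ _ fx _ → certificate₁≤ fx

theorem1 : (m k : ℕ) → .{{_ : NonZero m}} → m ≤ k →
    Σ ℕ λ n → Σ (BoolFun n) λ g →
      IsSensZ g false m × IsBsZ g false k ×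
      IsCertZ g true (⌊ 3 * ceilDiv k m /2⌋ + 1)
theorem1 m k m≤k = N , f , sensitivity₀ , block-sensitivity₀ ,
  subst (IsCertZ f true) (sym (⌊3n/2⌋+1≡n+1+⌊n/2⌋ t)) certificate₁
  where open Construction m k m≤k
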